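{- The triple $(\mathcal{H}_{\ge0,+},\sqcup,I)$ is the free commutative nonunitary Rota–Baxter $\mathbb{Q}$-algebra of weight $0$ generated by $[0]$: for every commutative nonunitary Rota–Baxter $\mathbb{Q}$-algebra $(R,P)$ of weight $0$ and every $r\in R$ there is a unique homomorphism of nonunitary Rota–Baxter algebras $f:\mathcal{H}_{\ge0,+}\to R$ with $f([0])=r$.
   Context: A nonunitary Rota–Baxter $\mathbb{Q}$-algebra of weight $0$ is a (not necessarily unital) $\mathbb{Q}$-algebra $R$ with linear $P:R\to R$ satisfying $P(x)P(y)=P(xP(y))+P(P(x)y)$; homomorphisms are algebra maps commuting with the operators. For $n=0,1$ let $\mathcal{H}_{\ge n,+}$ be the $\mathbb{Q}$-vector space with basis the symbols $[s_1,\dots,s_k]$, $k\ge1$, $s_i\in\mathbb{Z}_{\ge n}$. Let $I$ be the linear operator on $\mathcal{H}_{\ge0,+}$ with $I([s_1,s_2,\dots,s_k])=[s_1+1,s_2,\dots,s_k]$. On $\mathcal{H}_{\ge1,+}$ let $\sqcup$ be the product transported from the shuffle product of words: $[\vec s]\sqcup[\vec t]=\eta(\eta^{ -1}[\vec s]\sqcup\!\sqcup\eta^{ -1}[\vec t])$ where $\eta(x_0^{s_1-1}x_1\cdots x_0^{s_k-1}x_1)=[s_1,\dots,s_k]$ and $\sqcup\!\sqcup$ is the shuffle product of words in $x_0,x_1$ ($1\sqcup\!\sqcup w=w\sqcup\!\sqcup1=w$, $(au)\sqcup\!\sqcup(bv)=a(u\sqcup\!\sqcup bv)+b(au\sqcup\!\sqcup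 v)$). The product $\sqcup$ on $\mathcal{H}_{\ge0,+}$ is the unique commutative associative bilinear product extending this one such that $[0]\sqcup[\vec s]=[0,\vec s]$ for all basis elements $[\vec s]$ and such that $I$ is a Rota–Baxter operator of weight $0$; such a product exists and is unique. -}

module Defs where

open import Level using (Level; _⊔_)
open import Data.Nat as ℕ using (ℕ; zero; suc)
open import Data.List using (List; []; _∷_; _++_; map; concatMap)
open import Data.List.Properties using (≡-dec)
open import Data.Product using (_×_; _,_; Σ)
open import Data.Rational as ℚ using (ℚ; 0ℚ; 1ℚ)
open import Relation.Nullary using (yes; no)
open import Relation.Binary.Core using (Rel)
open import Relation.Binary.PropositionalEquality using (_≡_)
open import Algebra.Core using (Op₁; Op₂)
open import Algebra.Structures using (IsAbelianGroup)
open import Algebra.Definitions using (Congruent₂; Associative; Commutative; _DistributesOver_)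

-- A basis symbol [s₁,…,s_k] (k ≥ 1) is represented as the pair (s₁ , [s₂,…,s_k]).
Basis : Set
Basis = ℕ × List ℕ

toListB : Basis → List ℕ
toListB (a , as) = a ∷ as

-- Elements of H_{≥0,+}: finite formal ℚ-linear combinations of basis symbols.
H : Set
H = List (ℚ × Basis)

coeff : H → Basis → ℚ
coeff [] b = 0ℚ
coeff ((c , b') ∷ xs) b with ≡-dec ℕ._≟_ (toListB b') (toListB b)
... | yes _ = c ℚ.+ coeff xs b
... | no _  = coeff xs b

_≈H_ : Rel H Level.zero
x ≈H y = ∀ b → coeff x b ≡ coeff y b

gen : Basis → H
gen b = (1ℚ , b) ∷ []

[0] : H
[0] = gen (0 , [])

0H : H
0H = []

_+H_ : H → H → H
x +H y = x ++ y

_·H_ : ℚ → H → H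
c ·H x = map (λ { (d , b) → (c ℚ.* d , b) }) x

-H_ : H → H
-H x = map (λ { (d , b) → (ℚ.- d , b) }) x

I : H → H
I x = map (λ { (d , (a , as)) → (d , (suc a , as)) }) x

-- linear extension of [s⃗] ↦ [0,s⃗]  (= [0] ⊔ [s⃗])
pre0 : H → H
pre0 x = map (λ { (d , (a , as)) → (d , (0 , a ∷ as)) }) x

-- Product of basis symbols [a,as⃗] ⊔ [b,bs⃗], determined by commutativity,
-- [0] ⊔ [s⃗] = [0,s⃗], associativity and the weight-0 Rota–Baxter identity
--   I(X) ⊔ I(Y) = I(X ⊔ I(Y)) + I(I(X) ⊔ Y).
multB : ℕ → List ℕ → ℕ → List ℕ → H
multB zero []       b bs             = gen (0 , b ∷ bs)
multB zero (r ∷ rs) b bs             = pre0 (multB r rs b bs)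
multB (suc a) as zero []             = gen (0 , suc a ∷ as)
multB (suc a) as zero (r ∷ rs)       = pre0 (multB (suc a) as r rs)
multB (suc a) as (suc b) bs          =
  I (multB a as (suc b) bs) +H I (multB (suc a) as b bs)

_⊔H_ : H → H → H
x ⊔H y = concatMap (λ { (c , (a , as)) →
           concatMap (λ { (d , (b , bs)) → (c ℚ.* d) ·H multB a as b bs }) y }) x

record IsCRBAlgebra {c ℓ} {A : Set c} (_≈_ : Rel A ℓ)
         (_+_ : Op₂ A) (_*_ : Op₂ A) (0# : A) (-_ : Op₁ A)
         (_·_ : ℚ → A → A) (P : A → A) : Set (c ⊔ ℓ) where
  field
    +-isAbelianGroup : IsAbelianGroup _≈_ _+_ 0# -_
    ·-cong      : ∀ q {x y} → x ≈ y → (q · x) ≈ (q · y)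
    ·-distribˡ  : ∀ q x y → (q · (x + y)) ≈ ((q · x) + (q · y))
    ·-distribʳ  : ∀ p q x → ((p ℚ.+ q) · x) ≈ ((p · x) + (q · x))
    ·-assoc     : ∀ p q x → ((p ℚ.* q) · x) ≈ (p · (q · x))
    ·-identity  : ∀ x → (1ℚ · x) ≈ x
    *-cong      : Congruent₂ _≈_ _*_
    *-assoc     : Associative _≈_ _*_
    *-comm      : Commutative _≈_ _*_
    distrib     : _DistributesOver_ _≈_ _*_ _+_
    ·-*-assoc   : ∀ q x y → ((q · x) * y) ≈ (q · (x * y))
    P-cong      : ∀ {x y} → x ≈ y → P x ≈ P y
    P-+         : ∀ x y → P (x + y) ≈ (P x + P y)
    P-·         : ∀ q x → P (q · x) ≈ (q · P x)
    rota-baxter : ∀ x y → (P x * P y) ≈ (P (x * P y) + P (P x * y))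

record CRBAlgebra (c ℓ : Level) : Set (Level.suc (c ⊔ ℓ)) where
  infix  4 _≈_
  field
    Carrier : Set c
    _≈_     : Rel Carrier ℓ
    _+_     : Op₂ Carrier
    _*_     : Op₂ Carrier
    0#      : Carrier
    -_      : Op₁ Carrier
    _·_     : ℚ → Carrier → Carrier
    P       : Carrier → Carrier
    isCRBAlgebra : IsCRBAlgebra _≈_ _+_ _*_ 0# -_ _·_ P

record IsRBHom {c ℓ} (R : CRBAlgebra c ℓ) (f : H → CRBAlgebra.Carrier R) : Set ℓ where
  open CRBAlgebra R
  field
    f-cong : ∀ {x y} → x ≈H y → f x ≈ f y
    f-+    : ∀ x y → f (x +H y) ≈ (f x + f y)
    f-·    : ∀ q x → f (q ·H x) ≈ (q · f x)
    f-*    : ∀ x y → f (x ⊔H y) ≈ (f x * f y)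
    f-P    : ∀ x → f (I x) ≈ P (f x)

-- A linear map out of H is determined by its values on basis symbols, so every
-- (multi)linear identity needs checking on basis symbols only. There, commutativity and
-- associativity of ⊔ follow by well-founded induction on the weight of the symbols,
-- using that [0] ⊔ - is the prefixing map pre0 and that the Rota–Baxter identity for I
-- is the defining recursion of multB. The universal map sends [0] to r, [0,s⃗] to
-- r·f[s⃗] and [s₁+1,…] to P(f[s₁,…]); it is multiplicative because the recursion of multB
-- mirrors the Rota–Baxter identity in R, and it is unique because every basis symbol is
-- reached from [0] by I and by multiplication with [0].

module Submission where

open import Defs
open import Level using (Level; _⊔_)
open import Function.Base using (_∘_)
open import Data.Product using (_×_; Σ; _,_; proj₂; uncurry)
open import Data.Sum using (_⊎_; inj₁; inj₂)
open import Data.Nat as ℕ using (ℕ; zero; suc; _≤_; _<_; z≤n; s≤s)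
import Data.Nat.Properties as ℕₚ
open import Data.Nat.Induction using (<-wellFounded)
open import Data.Nat.Tactic.RingSolver using (solve-∀)
open import Induction.WellFounded using (Acc; acc)
open import Data.List using (List; []; _∷_; _++_; map; length; concatMap)
open import Data.Nat.ListAction using (sum)
open import Data.List.Properties using (≡-dec; map-++; ++-assoc; ++-identityʳ)
open import Data.Rational as ℚ using (ℚ; 0ℚ; 1ℚ)
import Data.Rational.Properties as ℚₚ
open import Data.Empty using (⊥-elim)
open import Relation.Nullary using (yes; no; ¬_)
open import Relation.Binary.Core using (Rel)
open import Relation.Binary.PropositionalEquality as ≡ using (_≡_; cong₂)
open import Algebra.Core using (Op₁; Op₂)
open import Algebra.Structures using (IsAbelianGroup)
open import Algebra.Bundles using (AbelianGroup)
import Algebra.Properties.AbelianGroup as AbelianGroupProperties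
import Algebra.Properties.CommutativeSemigroup as CommutativeSemigroupProperties
import Algebra.Construct.Subst.Equality as SubstEquality
import Relation.Binary.Reasoning.Setoid as SetoidReasoning

toListB-injective : ∀ {b b' : Basis} → toListB b ≡ toListB b' → b ≡ b'
toListB-injective {_ , _} ≡.refl = ≡.refl

coeff-∷-cong : ∀ c b' {xs ys} b → coeff xs b ≡ coeff ys b →
               coeff ((c , b') ∷ xs) b ≡ coeff ((c , b') ∷ ys) b
coeff-∷-cong c b' b eq with ≡-dec ℕ._≟_ (toListB b') (toListB b)
... | yes _ = ≡.cong (c ℚ.+_) eq
... | no _  = eq

coeff-∷-≢ : ∀ c b' xs b → ¬ toListB b' ≡ toListB b → coeff ((c , b') ∷ xs) b ≡ coeff xs b
coeff-∷-≢ c b' xs b b'≢b with ≡-dec ℕ._≟_ (toListB b') (toListB b)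
... | yes b'≡b = ⊥-elim (b'≢b b'≡b)
... | no _     = ≡.refl

coeff-++ : ∀ x y b → coeff (x ++ y) b ≡ coeff x b ℚ.+ coeff y b
coeff-++ [] y b = ≡.sym (ℚₚ.+-identityˡ _)
coeff-++ ((c , b') ∷ xs) y b with ≡-dec ℕ._≟_ (toListB b') (toListB b)
... | yes _ = ≡.trans (≡.cong (c ℚ.+_) (coeff-++ xs y b)) (≡.sym (ℚₚ.+-assoc c _ _))
... | no _  = coeff-++ xs y b

coeff-· : ∀ q x b → coeff (q ·H x) b ≡ q ℚ.* coeff x b
coeff-· q [] b = ≡.sym (ℚₚ.*-zeroʳ q)
coeff-· q ((c , b') ∷ xs) b with ≡-dec ℕ._≟_ (toListB b') (toListB b)
... | yes _ = ≡.trans (≡.cong ((q ℚ.* c) ℚ.+_) (coeff-· q xs b)) (≡.sym (ℚₚ.*-distribˡ-+ q c _))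
... | no _  = coeff-· q xs b

coeff-neg : ∀ x b → coeff (-H x) b ≡ ℚ.- coeff x b
coeff-neg [] b = ≡.refl
coeff-neg ((c , b') ∷ xs) b with ≡-dec ℕ._≟_ (toListB b') (toListB b)
... | yes _ = ≡.trans (≡.cong ((ℚ.- c) ℚ.+_) (coeff-neg xs b)) (≡.sym (ℚₚ.neg-distrib-+ c _))
... | no _  = coeff-neg xs b

remove : Basis → H → H
remove b [] = []
remove b ((d , b') ∷ xs) with ≡-dec ℕ._≟_ (toListB b') (toListB b)
... | yes _ = remove b xs
... | no _  = (d , b') ∷ remove b xs

length-remove : ∀ b x → length (remove b x) ≤ length x
length-remove b [] = z≤n
length-remove b ((d , b') ∷ xs) with ≡-dec ℕ._≟_ (toListB b') (toListB b)
... | yes _ = ℕₚ.m≤n⇒m≤1+n (length-remove b xs)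
... | no _  = s≤s (length-remove b xs)

length-remove-head : ∀ d b xs → length (remove b ((d , b) ∷ xs)) ≤ length xs
length-remove-head d b xs with ≡-dec ℕ._≟_ (toListB b) (toListB b)
... | yes _ = length-remove b xs
... | no b≢b = ⊥-elim (b≢b ≡.refl)

coeff-remove-self : ∀ b x → coeff (remove b x) b ≡ 0ℚ
coeff-remove-self b [] = ≡.refl
coeff-remove-self b ((d , b') ∷ xs) with ≡-dec ℕ._≟_ (toListB b') (toListB b)
... | yes _ = coeff-remove-self b xs
... | no b'≢b = ≡.trans (coeff-∷-≢ d b' (remove b xs) b b'≢b) (coeff-remove-self b xs)

coeff-remove-other : ∀ b x e → ¬ toListB b ≡ toListB e → coeff (remove b x) e ≡ coeff x e
coeff-remove-other b [] e b≢e = ≡.refl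
coeff-remove-other b ((d , b') ∷ xs) e b≢e with ≡-dec ℕ._≟_ (toListB b') (toListB b)
... | no _     = coeff-∷-cong d b' e (coeff-remove-other b xs e b≢e)
... | yes b'≡b = ≡.trans (coeff-remove-other b xs e b≢e)
                   (≡.sym (coeff-∷-≢ d b' xs e λ b'≡e → b≢e (≡.trans (≡.sym b'≡b) b'≡e)))

coeff-remove : ∀ b x e → coeff (remove b x) e ≡ 0ℚ ⊎ coeff (remove b x) e ≡ coeff x e
coeff-remove b x e with ≡-dec ℕ._≟_ (toListB b) (toListB e)
... | yes b≡e rewrite toListB-injective {b} {e} b≡e = inj₁ (coeff-remove-self e x)
... | no b≢e = inj₂ (coeff-remove-other b x e b≢e)

H-isAbelianGroup : IsAbelianGroup _≈H_ _+H_ 0H -H_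
H-isAbelianGroup = record
  { isGroup = record
    { isMonoid = record
      { isSemigroup = record
        { isMagma = record
          { isEquivalence = record
            { refl  = λ _ → ≡.refl
            ; sym   = λ x≈y b → ≡.sym (x≈y b)
            ; trans = λ x≈y y≈z b → ≡.trans (x≈y b) (y≈z b)
            }
          ; ∙-cong = λ {x} {y} {u} {v} x≈y u≈v b → begin
              coeff (x ++ u) b          ≡⟨ coeff-++ x u b ⟩
              coeff x b ℚ.+ coeff u b   ≡⟨ cong₂ ℚ._+_ (x≈y b) (u≈v b) ⟩
              coeff y b ℚ.+ coeff v b   ≡⟨ coeff-++ y v b ⟨
              coeff (y ++ v) b          ∎
          }
        ; assoc = λ x y z b → ≡.cong (λ w → coeff w b) (++-assoc x y z)
        }
      ; identity = (λ _ _ → ≡.refl) , (λ x b → ≡.cong (λ w → coeff w b) (++-identityʳ x))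
      }
    ; inverse =
        (λ x b → ≡.trans (coeff-++ (-H x) x b)
                  (≡.trans (≡.cong (ℚ._+ coeff x b) (coeff-neg x b)) (ℚₚ.+-inverseˡ (coeff x b))))
      , (λ x b → ≡.trans (coeff-++ x (-H x) b)
                  (≡.trans (≡.cong (coeff x b ℚ.+_) (coeff-neg x b)) (ℚₚ.+-inverseʳ (coeff x b))))
    ; ⁻¹-cong = λ {x} {y} x≈y b →
        ≡.trans (coeff-neg x b) (≡.trans (≡.cong ℚ.-_ (x≈y b)) (≡.sym (coeff-neg y b)))
    }
  ; comm = λ x y b →
      ≡.trans (coeff-++ x y b) (≡.trans (ℚₚ.+-comm (coeff x b) _) (≡.sym (coeff-++ y x b)))
  }
  where open ≡.≡-Reasoning

-- _≈H_ unfolds to a Π-type, from which Agda cannot infer the two sides;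
-- wrapping it in a record makes them inferable.
infix 4 _≈ʷ_

record _≈ʷ_ (x y : H) : Set where
  constructor wrap
  field unwrap : x ≈H y

open _≈ʷ_ public

record VectorSpace c ℓ : Set (Level.suc (c ⊔ ℓ)) where
  infix  4 _≈_
  infixl 6 _+_
  infixr 7 _·_
  field
    Carrier : Set c
    _≈_     : Rel Carrier ℓ
    _+_     : Op₂ Carrier
    0#      : Carrier
    -_      : Op₁ Carrier
    _·_     : ℚ → Carrier → Carrier
    +-isAbelianGroup : IsAbelianGroup _≈_ _+_ 0# -_
    ·-cong     : ∀ q {x y} → x ≈ y → q · x ≈ q · y
    ·-distribˡ : ∀ q x y → q · (x + y) ≈ q · x + q · y
    ·-distribʳ : ∀ p q x → (p ℚ.+ q) · x ≈ p · x + q · x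
    ·-assoc    : ∀ p q x → (p ℚ.* q) · x ≈ p · (q · x)
    ·-identity : ∀ x → 1ℚ · x ≈ x

  +-abelianGroup : AbelianGroup c ℓ
  +-abelianGroup = record { isAbelianGroup = +-isAbelianGroup }

  open AbelianGroup +-abelianGroup public
    using (setoid; refl; sym; trans; reflexive; assoc; comm; identityˡ; identityʳ)
    renaming (∙-cong to +-cong; ∙-congˡ to +-congˡ; ∙-congʳ to +-congʳ)
  open AbelianGroupProperties +-abelianGroup public
    using (identityˡ-unique; inverseʳ-unique; x∙y⁻¹≈ε⇒x≈y; ε⁻¹≈ε; ⁻¹-∙-comm)
  open CommutativeSemigroupProperties (AbelianGroup.commutativeSemigroup +-abelianGroup) public
    using (interchange; x∙yz≈y∙xz)

  ·-zeroˡ : ∀ x → 0ℚ · x ≈ 0#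
  ·-zeroˡ x = identityˡ-unique (0ℚ · x) (0ℚ · x)
    (trans (sym (·-distribʳ 0ℚ 0ℚ x)) (reflexive (≡.cong (_· x) (ℚₚ.+-identityʳ 0ℚ))))

  ·-zeroʳ : ∀ q → q · 0# ≈ 0#
  ·-zeroʳ q = identityˡ-unique (q · 0#) (q · 0#)
    (trans (sym (·-distribˡ q 0# 0#)) (·-cong q (identityʳ 0#)))

  ·-neg : ∀ q x → (ℚ.- q) · x ≈ - (q · x)
  ·-neg q x = inverseʳ-unique (q · x) ((ℚ.- q) · x)
    (trans (sym (·-distribʳ q (ℚ.- q) x))
           (trans (reflexive (≡.cong (_· x) (ℚₚ.+-inverseʳ q))) (·-zeroˡ x)))

H-vectorSpace : VectorSpace Level.zero Level.zero
H-vectorSpace = record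
  { Carrier    = H
  ; _≈_        = _≈ʷ_
  ; _+_        = _+H_
  ; 0#         = 0H
  ; -_         = -H_
  ; _·_        = _·H_
  ; +-isAbelianGroup = SubstEquality.isAbelianGroup (wrap , unwrap) H-isAbelianGroup
  ; ·-cong     = λ q {x} {y} x≈y → wrap λ b →
      ≡.trans (coeff-· q x b) (≡.trans (≡.cong (q ℚ.*_) (unwrap x≈y b)) (≡.sym (coeff-· q y b)))
  ; ·-distribˡ = λ q x y → wrap λ b → ≡.cong (λ w → coeff w b) (map-++ _ x y)
  ; ·-distribʳ = λ p q x → wrap λ b → begin
      coeff ((p ℚ.+ q) ·H x) b                    ≡⟨ coeff-· (p ℚ.+ q) x b ⟩
      (p ℚ.+ q) ℚ.* coeff x b                     ≡⟨ ℚₚ.*-distribʳ-+ (coeff x b) p q ⟩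
      p ℚ.* coeff x b ℚ.+ q ℚ.* coeff x b         ≡⟨ cong₂ ℚ._+_ (coeff-· p x b) (coeff-· q x b) ⟨
      coeff (p ·H x) b ℚ.+ coeff (q ·H x) b       ≡⟨ coeff-++ (p ·H x) (q ·H x) b ⟨
      coeff ((p ·H x) +H (q ·H x)) b              ∎
  ; ·-assoc    = λ p q x → wrap λ b → begin
      coeff ((p ℚ.* q) ·H x) b     ≡⟨ coeff-· (p ℚ.* q) x b ⟩
      (p ℚ.* q) ℚ.* coeff x b      ≡⟨ ℚₚ.*-assoc p q (coeff x b) ⟩
      p ℚ.* (q ℚ.* coeff x b)      ≡⟨ ≡.cong (p ℚ.*_) (coeff-· q x b) ⟨
      p ℚ.* coeff (q ·H x) b       ≡⟨ coeff-· p (q ·H x) b ⟨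
      coeff (p ·H (q ·H x)) b      ∎
  ; ·-identity = λ x → wrap λ b → ≡.trans (coeff-· 1ℚ x b) (ℚₚ.*-identityˡ (coeff x b))
  }
  where open ≡.≡-Reasoning

module _ {c₁ ℓ₁ c₂ ℓ₂} (V : VectorSpace c₁ ℓ₁) (W : VectorSpace c₂ ℓ₂) where
  private
    module V = VectorSpace V
    module W = VectorSpace W

  record IsLinear (φ : V.Carrier → W.Carrier) : Set (c₁ ⊔ ℓ₁ ⊔ ℓ₂) where
    field
      cong   : ∀ {x y} → x V.≈ y → φ x W.≈ φ y
      homo-+ : ∀ x y → φ (x V.+ y) W.≈ φ x W.+ φ y
      homo-· : ∀ q x → φ (q V.· x) W.≈ q W.· φ x

    homo-0 : φ V.0# W.≈ W.0#
    homo-0 = W.identityˡ-unique (φ V.0#) (φ V.0#)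
      (W.trans (W.sym (homo-+ V.0# V.0#)) (cong (V.identityʳ V.0#)))

  linear-resp : ∀ {φ ψ} → (∀ x → φ x W.≈ ψ x) → IsLinear φ → IsLinear ψ
  linear-resp φ≈ψ φ-lin = record
    { cong   = λ x≈y → W.trans (W.sym (φ≈ψ _)) (W.trans (cong x≈y) (φ≈ψ _))
    ; homo-+ = λ x y → W.trans (W.sym (φ≈ψ (x V.+ y))) (W.trans (homo-+ x y) (W.+-cong (φ≈ψ x) (φ≈ψ y)))
    ; homo-· = λ q x → W.trans (W.sym (φ≈ψ (q V.· x))) (W.trans (homo-· q x) (W.·-cong q (φ≈ψ x)))
    }
    where open IsLinear φ-lin

  +-linear : ∀ {φ ψ} → IsLinear φ → IsLinear ψ → IsLinear (λ x → φ x W.+ ψ x)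
  +-linear φ-lin ψ-lin = record
    { cong   = λ x≈y → W.+-cong (Φ.cong x≈y) (Ψ.cong x≈y)
    ; homo-+ = λ x y → W.trans (W.+-cong (Φ.homo-+ x y) (Ψ.homo-+ x y)) (W.interchange _ _ _ _)
    ; homo-· = λ q x → W.trans (W.+-cong (Φ.homo-· q x) (Ψ.homo-· q x)) (W.sym (W.·-distribˡ q _ _))
    }
    where module Φ = IsLinear φ-lin
          module Ψ = IsLinear ψ-lin

∘-linear : ∀ {c₁ ℓ₁ c₂ ℓ₂ c₃ ℓ₃} {U : VectorSpace c₁ ℓ₁} {V : VectorSpace c₂ ℓ₂} {W : VectorSpace c₃ ℓ₃}
           {φ : VectorSpace.Carrier V → VectorSpace.Carrier W}
           {ψ : VectorSpace.Carrier U → VectorSpace.Carrier V} →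
           IsLinear V W φ → IsLinear U V ψ → IsLinear U W (φ ∘ ψ)
∘-linear {W = W} φ-lin ψ-lin = record
  { cong   = λ x≈y → Φ.cong (Ψ.cong x≈y)
  ; homo-+ = λ x y → W.trans (Φ.cong (Ψ.homo-+ x y)) (Φ.homo-+ _ _)
  ; homo-· = λ q x → W.trans (Φ.cong (Ψ.homo-· q x)) (Φ.homo-· q _)
  }
  where module W = VectorSpace W
        module Φ = IsLinear φ-lin
        module Ψ = IsLinear ψ-lin

module Extension {c ℓ} (W : VectorSpace c ℓ) where
  open VectorSpace W
  open SetoidReasoning setoid

  extend : (Basis → Carrier) → H → Carrier
  extend F [] = 0#
  extend F ((q , b) ∷ x) = q · F b + extend F x

  extend-++ : ∀ F x y → extend F (x ++ y) ≈ extend F x + extend F y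
  extend-++ F [] y = sym (identityˡ _)
  extend-++ F ((q , b) ∷ x) y = trans (+-congˡ (extend-++ F x y)) (sym (assoc _ _ _))

  extend-· : ∀ F q x → extend F (q ·H x) ≈ q · extend F x
  extend-· F q [] = sym (·-zeroʳ q)
  extend-· F q ((d , b) ∷ x) =
    trans (+-cong (·-assoc q d (F b)) (extend-· F q x)) (sym (·-distribˡ q _ _))

  extend-neg : ∀ F x → extend F (-H x) ≈ - extend F x
  extend-neg F [] = sym ε⁻¹≈ε
  extend-neg F ((d , b) ∷ x) =
    trans (+-cong (·-neg d (F b)) (extend-neg F x)) (⁻¹-∙-comm _ _)

  extend-remove : ∀ F x b → extend F x ≈ coeff x b · F b + extend F (remove b x)
  extend-remove F [] b = sym (trans (+-congʳ (·-zeroˡ (F b))) (identityʳ 0#))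
  extend-remove F ((d , b') ∷ xs) b with ≡-dec ℕ._≟_ (toListB b') (toListB b)
  ... | yes b'≡b rewrite toListB-injective {b'} {b} b'≡b = begin
    d · F b + extend F xs                                          ≈⟨ +-congˡ (extend-remove F xs b) ⟩
    d · F b + (coeff xs b · F b + extend F (remove b xs))          ≈⟨ assoc _ _ _ ⟨
    (d · F b + coeff xs b · F b) + extend F (remove b xs)          ≈⟨ +-congʳ (·-distribʳ d (coeff xs b) (F b)) ⟨
    (d ℚ.+ coeff xs b) · F b + extend F (remove b xs)              ∎
  ... | no _ = trans (+-congˡ (extend-remove F xs b)) (x∙yz≈y∙xz _ _ _)

  extend-zero : ∀ F x → (∀ b → coeff x b ≡ 0ℚ) → extend F x ≈ 0#
  extend-zero F x = bounded (length x) x ℕₚ.≤-refl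
    where
    bounded : ∀ n x → length x ≤ n → (∀ b → coeff x b ≡ 0ℚ) → extend F x ≈ 0#
    bounded _ [] _ _ = refl
    bounded (suc n) x@((d , b) ∷ xs) (s≤s |xs|≤n) x≈0 = begin
      extend F x                                  ≈⟨ extend-remove F x b ⟩
      coeff x b · F b + extend F (remove b x)     ≈⟨ +-cong b-term rest ⟩
      0# + 0#                                     ≈⟨ identityʳ 0# ⟩
      0#                                          ∎
      where
      b-term : coeff x b · F b ≈ 0#
      b-term = trans (reflexive (≡.cong (_· F b) (x≈0 b))) (·-zeroˡ (F b))
      rest-coeff : ∀ e → coeff (remove b x) e ≡ 0ℚ
      rest-coeff e with coeff-remove b x e
      ... | inj₁ removed = removed
      ... | inj₂ kept    = ≡.trans kept (x≈0 e)
      rest : extend F (remove b x) ≈ 0#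
      rest = bounded n (remove b x) (ℕₚ.≤-trans (length-remove-head d b xs) |xs|≤n) rest-coeff

  extend-cong : ∀ F {x y} → x ≈ʷ y → extend F x ≈ extend F y
  extend-cong F {x} {y} x≈y = x∙y⁻¹≈ε⇒x≈y (extend F x) (extend F y) (begin
    extend F x + - extend F y           ≈⟨ +-congˡ (extend-neg F y) ⟨
    extend F x + extend F (-H y)        ≈⟨ extend-++ F x (-H y) ⟨
    extend F (x ++ -H y)                ≈⟨ extend-zero F (x ++ -H y) difference-vanishes ⟩
    0#                                  ∎)
    where
    difference-vanishes : ∀ b → coeff (x ++ -H y) b ≡ 0ℚ
    difference-vanishes b = ≡.trans (coeff-++ x (-H y) b)
      (≡.trans (cong₂ ℚ._+_ (unwrap x≈y b) (coeff-neg y b)) (ℚₚ.+-inverseʳ (coeff y b)))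

  extend-linear : ∀ F → IsLinear H-vectorSpace W (extend F)
  extend-linear F = record { cong = extend-cong F ; homo-+ = extend-++ F ; homo-· = extend-· F }

  extend-gen : ∀ F b → extend F (gen b) ≈ F b
  extend-gen F b = trans (identityʳ _) (·-identity (F b))

  extend-congᶠ : ∀ {F G} → (∀ b → F b ≈ G b) → ∀ x → extend F x ≈ extend G x
  extend-congᶠ F≈G [] = refl
  extend-congᶠ F≈G ((q , b) ∷ x) = +-cong (·-cong q (F≈G b)) (extend-congᶠ F≈G x)

  extend-+ᶠ : ∀ F G x → extend (λ b → F b + G b) x ≈ extend F x + extend G x
  extend-+ᶠ F G [] = sym (identityʳ 0#)
  extend-+ᶠ F G ((q , b) ∷ x) =
    trans (+-cong (·-distribˡ q _ _) (extend-+ᶠ F G x)) (interchange _ _ _ _)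

  extend-·ᶠ : ∀ F q x → extend (λ b → q · F b) x ≈ q · extend F x
  extend-·ᶠ F q [] = sym (·-zeroʳ q)
  extend-·ᶠ F q ((d , b) ∷ x) = begin
    d · (q · F b) + extend (λ b → q · F b) x     ≈⟨ +-cong scalars-commute (extend-·ᶠ F q x) ⟩
    q · (d · F b) + q · extend F x               ≈⟨ ·-distribˡ q _ _ ⟨
    q · (d · F b + extend F x)                   ∎
    where
    scalars-commute : d · (q · F b) ≈ q · (d · F b)
    scalars-commute = trans (sym (·-assoc d q (F b)))
      (trans (reflexive (≡.cong (_· F b) (ℚₚ.*-comm d q))) (·-assoc q d (F b)))

extend-natural : ∀ {c₁ ℓ₁ c₂ ℓ₂} {V : VectorSpace c₁ ℓ₁} {W : VectorSpace c₂ ℓ₂}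
                 {φ : VectorSpace.Carrier V → VectorSpace.Carrier W} → IsLinear V W φ →
                 ∀ F x → VectorSpace._≈_ W (φ (Extension.extend V F x)) (Extension.extend W (φ ∘ F) x)
extend-natural φ-lin F [] = IsLinear.homo-0 φ-lin
extend-natural {W = W} φ-lin F ((q , b) ∷ x) =
  W.trans (homo-+ _ _) (W.+-cong (homo-· q (F b)) (extend-natural φ-lin F x))
  where module W = VectorSpace W
        open IsLinear φ-lin

module H = VectorSpace H-vectorSpace
open Extension H-vectorSpace

∷-cong : ∀ {c c'} b {xs ys} → c ≡ c' → xs ≈ʷ ys → ((c , b) ∷ xs) ≈ʷ ((c' , b) ∷ ys)
∷-cong b ≡.refl xs≈ys = wrap λ e → coeff-∷-cong _ b e (unwrap xs≈ys e)

extend-gen-id : ∀ x → extend gen x ≈ʷ x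
extend-gen-id [] = H.refl
extend-gen-id ((c , b) ∷ x) = ∷-cong b (ℚₚ.*-identityʳ c) (extend-gen-id x)

module _ {c ℓ} (W : VectorSpace c ℓ) where
  private module W = VectorSpace W

  record IsBilinear (Φ : H → H → W.Carrier) : Set (c ⊔ ℓ) where
    field
      linearˡ : ∀ y → IsLinear H-vectorSpace W (λ x → Φ x y)
      linearʳ : ∀ x → IsLinear H-vectorSpace W (Φ x)

module _ {c ℓ} {W : VectorSpace c ℓ} where
  private
    module W = VectorSpace W
    module EW = Extension W

  linear-ext : ∀ {φ ψ} → IsLinear H-vectorSpace W φ → IsLinear H-vectorSpace W ψ →
               (∀ b → φ (gen b) W.≈ ψ (gen b)) → ∀ x → φ x W.≈ ψ x
  linear-ext {φ} {ψ} φ-lin ψ-lin φ≈ψ x = begin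
    φ x                      ≈⟨ IsLinear.cong φ-lin (H.sym (extend-gen-id x)) ⟩
    φ (extend gen x)         ≈⟨ extend-natural φ-lin gen x ⟩
    EW.extend (φ ∘ gen) x    ≈⟨ EW.extend-congᶠ φ≈ψ x ⟩
    EW.extend (ψ ∘ gen) x    ≈⟨ extend-natural ψ-lin gen x ⟨
    ψ (extend gen x)         ≈⟨ IsLinear.cong ψ-lin (extend-gen-id x) ⟩
    ψ x                      ∎
    where open SetoidReasoning W.setoid

  bilinear-ext : ∀ {Φ Ψ} → IsBilinear W Φ → IsBilinear W Ψ →
                 (∀ b c → Φ (gen b) (gen c) W.≈ Ψ (gen b) (gen c)) → ∀ x y → Φ x y W.≈ Ψ x y
  bilinear-ext Φ-bil Ψ-bil Φ≈Ψ x y =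
    linear-ext (Φ.linearˡ y) (Ψ.linearˡ y)
      (λ b → linear-ext (Φ.linearʳ (gen b)) (Ψ.linearʳ (gen b)) (Φ≈Ψ b) y) x
    where module Φ = IsBilinear Φ-bil
          module Ψ = IsBilinear Ψ-bil

  flip-bilinear : ∀ {Φ} → IsBilinear W Φ → IsBilinear W (λ x y → Φ y x)
  flip-bilinear Φ-bil = record { linearˡ = IsBilinear.linearʳ Φ-bil ; linearʳ = IsBilinear.linearˡ Φ-bil }

relabel : (Basis → Basis) → H → H
relabel σ = map (λ (d , b) → (d , σ b))

relabel-linear : ∀ σ → IsLinear H-vectorSpace H-vectorSpace (relabel σ)
relabel-linear σ = linear-resp H-vectorSpace H-vectorSpace extend≈relabel (extend-linear (gen ∘ σ))
  where
  extend≈relabel : ∀ x → extend (gen ∘ σ) x ≈ʷ relabel σ x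
  extend≈relabel [] = H.refl
  extend≈relabel ((c , b) ∷ x) = ∷-cong (σ b) (ℚₚ.*-identityʳ c) (extend≈relabel x)

Iᴮ : Basis → Basis
Iᴮ (a , as) = (suc a , as)

pre0ᴮ : Basis → Basis
pre0ᴮ (a , as) = (0 , a ∷ as)

-- I and pre0 of Defs are, definitionally, relabel Iᴮ and relabel pre0ᴮ.
I-linear : IsLinear H-vectorSpace H-vectorSpace I
I-linear = relabel-linear Iᴮ

pre0-linear : IsLinear H-vectorSpace H-vectorSpace pre0
pre0-linear = relabel-linear pre0ᴮ

I-cong : ∀ {x y} → x ≈ʷ y → I x ≈ʷ I y
I-cong = IsLinear.cong I-linear

pre0-cong : ∀ {x y} → x ≈ʷ y → pre0 x ≈ʷ pre0 y
pre0-cong = IsLinear.cong pre0-linear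

module Shuffle where

  infix 25 _⊔ᴮ_

  _⊔ᴮ_ : Basis → Basis → H
  (a , as) ⊔ᴮ (b , bs) = multB a as b bs

  -- The product _⊔H_ of Defs in the form of an iterated linear extension (see ⊔H≈*),
  -- so that bilinearity comes for free.
  infixl 25 _*_
  _*_ : H → H → H
  x * y = extend (λ b → extend (b ⊔ᴮ_) y) x

  *-linearˡ : ∀ y → IsLinear H-vectorSpace H-vectorSpace (_* y)
  *-linearˡ y = extend-linear _

  *-linearʳ : ∀ x → IsLinear H-vectorSpace H-vectorSpace (x *_)
  *-linearʳ x = record
    { cong   = λ y≈z → extend-congᶠ (λ b → extend-cong (b ⊔ᴮ_) y≈z) x
    ; homo-+ = λ y z → H.trans (extend-congᶠ (λ b → extend-++ (b ⊔ᴮ_) y z) x) (extend-+ᶠ _ _ x)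
    ; homo-· = λ q y → H.trans (extend-congᶠ (λ b → extend-· (b ⊔ᴮ_) q y) x) (extend-·ᶠ _ q x)
    }

  *-bilinear : IsBilinear H-vectorSpace _*_
  *-bilinear = record { linearˡ = *-linearˡ ; linearʳ = *-linearʳ }

  *-congˡ : ∀ y {x x'} → x ≈ʷ x' → x * y ≈ʷ x' * y
  *-congˡ y = IsLinear.cong (*-linearˡ y)

  *-congʳ : ∀ x {y y'} → y ≈ʷ y' → x * y ≈ʷ x * y'
  *-congʳ x = IsLinear.cong (*-linearʳ x)

  gen-* : ∀ b y → gen b * y ≈ʷ extend (b ⊔ᴮ_) y
  gen-* b y = extend-gen (λ b' → extend (b' ⊔ᴮ_) y) b

  gen-*-gen : ∀ b c → gen b * gen c ≈ʷ b ⊔ᴮ c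
  gen-*-gen b c = H.trans (gen-* b (gen c)) (extend-gen (b ⊔ᴮ_) c)

  ⊔H≈* : ∀ x y → x ⊔H y ≈ʷ x * y
  ⊔H≈* [] y = H.refl
  ⊔H≈* ((c , b) ∷ x) y = H.+-cong (row y) (⊔H≈* x y)
    where
    row : ∀ y → concatMap (λ (d , b') → (c ℚ.* d) ·H (b ⊔ᴮ b')) y ≈ʷ c ·H extend (b ⊔ᴮ_) y
    row [] = H.refl
    row ((d , b') ∷ y) = H.trans (H.+-cong (H.·-assoc c d (b ⊔ᴮ b')) (row y))
                                 (H.sym (H.·-distribˡ c (d ·H (b ⊔ᴮ b')) (extend (b ⊔ᴮ_) y)))

  weight : Basis → ℕ
  weight (a , as) = a ℕ.+ sum (map suc as)

  ⊔ᴮ-comm : ∀ b c → b ⊔ᴮ c ≈ʷ c ⊔ᴮ b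
  ⊔ᴮ-comm b c = go b c (<-wellFounded (weight b ℕ.+ weight c))
    where
    open SetoidReasoning H.setoid
    go : ∀ b c → Acc _<_ (weight b ℕ.+ weight c) → b ⊔ᴮ c ≈ʷ c ⊔ᴮ b
    go (0 , [])     (0 , [])     _         = H.refl
    go (0 , [])     (0 , s ∷ ss) (acc rec) =
      H.sym (pre0-cong (go (s , ss) (0 , []) (rec (ℕₚ.≤-reflexive (≡.cong suc (ℕₚ.+-identityʳ _))))))
    go (0 , [])     (suc _ , _)  _         = H.refl
    go (0 , r ∷ rs) (0 , [])     (acc rec) = pre0-cong (go (r , rs) (0 , []) (rec (ℕₚ.n<1+n _)))
    go (0 , r ∷ rs) (0 , s ∷ ss) (acc rec) = begin
      pre0 ((r , rs) ⊔ᴮ (0 , s ∷ ss))       ≈⟨ pre0-cong (go (r , rs) (0 , s ∷ ss) (rec (ℕₚ.n<1+n _))) ⟩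
      pre0 (pre0 ((s , ss) ⊔ᴮ (r , rs)))    ≈⟨ pre0-cong (pre0-cong (go (s , ss) (r , rs) (rec tails<))) ⟩
      pre0 (pre0 ((r , rs) ⊔ᴮ (s , ss)))    ≈⟨ pre0-cong (go (s , ss) (0 , r ∷ rs) (rec swapped<)) ⟨
      pre0 ((s , ss) ⊔ᴮ (0 , r ∷ rs))       ∎
      where
      R = weight (r , rs)
      S = weight (s , ss)
      eq₁ : ∀ r s → suc (suc (s ℕ.+ r)) ≡ suc r ℕ.+ suc s
      eq₁ = solve-∀
      eq₂ : ∀ r s → suc (s ℕ.+ suc r) ≡ suc r ℕ.+ suc s
      eq₂ = solve-∀
      tails< : S ℕ.+ R < suc R ℕ.+ suc S
      tails< = ℕₚ.<-trans (ℕₚ.n<1+n _) (ℕₚ.≤-reflexive (eq₁ R S))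
      swapped< : S ℕ.+ suc R < suc R ℕ.+ suc S
      swapped< = ℕₚ.≤-reflexive (eq₂ R S)
    go (0 , r ∷ rs) (suc b , bs) (acc rec) = pre0-cong (go (r , rs) (suc b , bs) (rec (ℕₚ.n<1+n _)))
    go (suc a , as) (0 , [])     _         = H.refl
    go (suc a , as) (0 , s ∷ ss) (acc rec) =
      pre0-cong (go (suc a , as) (s , ss) (rec (ℕₚ.+-monoʳ-< (suc (weight (a , as))) (ℕₚ.n<1+n _))))
    go (suc a , as) (suc b , bs) (acc rec) = begin
      I ((a , as) ⊔ᴮ (suc b , bs)) +H I ((suc a , as) ⊔ᴮ (b , bs))
        ≈⟨ H.+-cong (I-cong (go (a , as) (suc b , bs) (rec (ℕₚ.n<1+n _))))
                    (I-cong (go (suc a , as) (b , bs) (rec (ℕₚ.+-monoʳ-< (suc (weight (a , as))) (ℕₚ.n<1+n _))))) ⟩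
      I ((suc b , bs) ⊔ᴮ (a , as)) +H I ((b , bs) ⊔ᴮ (suc a , as))
        ≈⟨ H.comm (I ((suc b , bs) ⊔ᴮ (a , as))) (I ((b , bs) ⊔ᴮ (suc a , as))) ⟩
      I ((b , bs) ⊔ᴮ (suc a , as)) +H I ((suc b , bs) ⊔ᴮ (a , as))  ∎

  *-comm : ∀ x y → x * y ≈ʷ y * x
  *-comm = bilinear-ext *-bilinear (flip-bilinear *-bilinear) λ b c →
    H.trans (gen-*-gen b c) (H.trans (⊔ᴮ-comm b c) (H.sym (gen-*-gen c b)))

  [0]-* : ∀ y → [0] * y ≈ʷ pre0 y
  [0]-* = linear-ext (*-linearʳ [0]) pre0-linear (gen-*-gen (0 , []))

  pre0-* : ∀ x y → pre0 x * y ≈ʷ pre0 (x * y)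
  pre0-* x y = linear-ext (∘-linear (*-linearˡ y) pre0-linear) (∘-linear pre0-linear (*-linearˡ y)) on-gen x
    where
    open SetoidReasoning H.setoid
    on-gen : ∀ b → pre0 (gen b) * y ≈ʷ pre0 (gen b * y)
    on-gen b = begin
      gen (pre0ᴮ b) * y          ≈⟨ gen-* (pre0ᴮ b) y ⟩
      extend (pre0 ∘ (b ⊔ᴮ_)) y  ≈⟨ extend-natural pre0-linear (b ⊔ᴮ_) y ⟨
      pre0 (extend (b ⊔ᴮ_) y)    ≈⟨ pre0-cong (gen-* b y) ⟨
      pre0 (gen b * y)           ∎

  rota-baxter : ∀ x y → I x * I y ≈ʷ I (x * I y) +H I (I x * y)
  rota-baxter = bilinear-ext
    (record { linearˡ = λ y → ∘-linear (*-linearˡ (I y)) I-linear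
            ; linearʳ = λ x → ∘-linear (*-linearʳ (I x)) I-linear })
    (record { linearˡ = λ y → +-linear H-vectorSpace H-vectorSpace
                                (∘-linear I-linear (*-linearˡ (I y)))
                                (∘-linear I-linear (∘-linear (*-linearˡ y) I-linear))
            ; linearʳ = λ x → +-linear H-vectorSpace H-vectorSpace
                                (∘-linear I-linear (∘-linear (*-linearʳ x) I-linear))
                                (∘-linear I-linear (*-linearʳ (I x))) })
    λ b c → H.trans (gen-*-gen (Iᴮ b) (Iᴮ c))
              (H.sym (H.+-cong (I-cong (gen-*-gen b (Iᴮ c))) (I-cong (gen-*-gen (Iᴮ b) c))))

  *-distribʳ : ∀ x y z → (x +H y) * z ≈ʷ x * z +H y * z
  *-distribʳ x y z = IsLinear.homo-+ (*-linearˡ z) x y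

  *-distribˡ : ∀ x y z → x * (y +H z) ≈ʷ x * y +H x * z
  *-distribˡ x = IsLinear.homo-+ (*-linearʳ x)

  Associates : H → H → H → Set
  Associates x y z = x * y * z ≈ʷ x * (y * z)

  module _ where
    open SetoidReasoning H.setoid

    associates-flip : ∀ x y z → Associates z y x → Associates x y z
    associates-flip x y z zyx = begin
      x * y * z      ≈⟨ *-comm (x * y) z ⟩
      z * (x * y)    ≈⟨ *-congʳ z (*-comm x y) ⟩
      z * (y * x)    ≈⟨ zyx ⟨
      z * y * x      ≈⟨ *-comm (z * y) x ⟩
      x * (z * y)    ≈⟨ *-congʳ x (*-comm z y) ⟩
      x * (y * z)    ∎

    associates-[0]ˡ : ∀ y z → Associates [0] y z
    associates-[0]ˡ y z = begin
      [0] * y * z      ≈⟨ *-congˡ z ([0]-* y) ⟩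
      pre0 y * z       ≈⟨ pre0-* y z ⟩
      pre0 (y * z)     ≈⟨ [0]-* (y * z) ⟨
      [0] * (y * z)    ∎

    associates-pre0ˡ : ∀ x y z → Associates x y z → Associates (pre0 x) y z
    associates-pre0ˡ x y z xyz = begin
      pre0 x * y * z        ≈⟨ *-congˡ z (pre0-* x y) ⟩
      pre0 (x * y) * z      ≈⟨ pre0-* (x * y) z ⟩
      pre0 (x * y * z)      ≈⟨ pre0-cong xyz ⟩
      pre0 (x * (y * z))    ≈⟨ pre0-* x (y * z) ⟨
      pre0 x * (y * z)      ∎

    associates-[0]-middle : ∀ x z → Associates x [0] z
    associates-[0]-middle x z = begin
      x * [0] * z       ≈⟨ *-congˡ z (H.trans (*-comm x [0]) ([0]-* x)) ⟩
      pre0 x * z        ≈⟨ pre0-* x z ⟩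
      pre0 (x * z)      ≈⟨ pre0-cong (*-comm x z) ⟩
      pre0 (z * x)      ≈⟨ pre0-* z x ⟨
      pre0 z * x        ≈⟨ *-comm (pre0 z) x ⟩
      x * pre0 z        ≈⟨ *-congʳ x ([0]-* z) ⟨
      x * ([0] * z)     ∎

    associates-pre0-middle : ∀ x y z → Associates y x z → Associates y z x → Associates x (pre0 y) z
    associates-pre0-middle x y z yxz yzx = begin
      x * pre0 y * z        ≈⟨ *-congˡ z (H.trans (*-comm x (pre0 y)) (pre0-* y x)) ⟩
      pre0 (y * x) * z      ≈⟨ pre0-* (y * x) z ⟩
      pre0 (y * x * z)      ≈⟨ pre0-cong yxz ⟩
      pre0 (y * (x * z))    ≈⟨ pre0-cong (*-congʳ y (*-comm x z)) ⟩
      pre0 (y * (z * x))    ≈⟨ pre0-cong yzx ⟨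
      pre0 (y * z * x)      ≈⟨ pre0-* (y * z) x ⟨
      pre0 (y * z) * x      ≈⟨ *-comm (pre0 (y * z)) x ⟩
      x * pre0 (y * z)      ≈⟨ *-congʳ x (pre0-* y z) ⟨
      x * (pre0 y * z)      ∎

    rota-baxter-expandˡ : ∀ x y z →
      I x * I y * I z ≈ʷ (I (x * I y * I z) +H I (I x * y * I z)) +H I (I x * I y * z)
    rota-baxter-expandˡ x y z = begin
      I x * I y * I z
        ≈⟨ *-congˡ (I z) (rota-baxter x y) ⟩
      (I (x * I y) +H I (I x * y)) * I z
        ≈⟨ *-distribʳ (I (x * I y)) (I (I x * y)) (I z) ⟩
      I (x * I y) * I z +H I (I x * y) * I z
        ≈⟨ H.+-cong (rota-baxter (x * I y) z) (rota-baxter (I x * y) z) ⟩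
      (I (x * I y * I z) +H I (I (x * I y) * z)) +H (I (I x * y * I z) +H I (I (I x * y) * z))
        ≈⟨ H.interchange (I (x * I y * I z)) (I (I (x * I y) * z)) (I (I x * y * I z)) (I (I (I x * y) * z)) ⟩
      (I (x * I y * I z) +H I (I x * y * I z)) +H (I (I (x * I y) * z) +H I (I (I x * y) * z))
        ≈⟨ H.+-congˡ (H.sym (IsLinear.homo-+ I-linear (I (x * I y) * z) (I (I x * y) * z))) ⟩
      (I (x * I y * I z) +H I (I x * y * I z)) +H I (I (x * I y) * z +H I (I x * y) * z)
        ≈⟨ H.+-congˡ (I-cong (H.trans (H.sym (*-distribʳ (I (x * I y)) (I (I x * y)) z)) (*-congˡ z (H.sym (rota-baxter x y))))) ⟩
      (I (x * I y * I z) +H I (I x * y * I z)) +H I (I x * I y * z)  ∎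

    rota-baxter-expandʳ : ∀ x y z →
      I x * (I y * I z) ≈ʷ (I (x * (I y * I z)) +H I (I x * (y * I z))) +H I (I x * (I y * z))
    rota-baxter-expandʳ x y z = begin
      I x * (I y * I z)
        ≈⟨ *-congʳ (I x) (rota-baxter y z) ⟩
      I x * (I (y * I z) +H I (I y * z))
        ≈⟨ *-distribˡ (I x) (I (y * I z)) (I (I y * z)) ⟩
      I x * I (y * I z) +H I x * I (I y * z)
        ≈⟨ H.+-cong (rota-baxter x (y * I z)) (rota-baxter x (I y * z)) ⟩
      (I (x * I (y * I z)) +H I (I x * (y * I z))) +H (I (x * I (I y * z)) +H I (I x * (I y * z)))
        ≈⟨ H.interchange (I (x * I (y * I z))) (I (I x * (y * I z))) (I (x * I (I y * z))) (I (I x * (I y * z))) ⟩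
      (I (x * I (y * I z)) +H I (x * I (I y * z))) +H (I (I x * (y * I z)) +H I (I x * (I y * z)))
        ≈⟨ H.+-congʳ (H.sym (IsLinear.homo-+ I-linear (x * I (y * I z)) (x * I (I y * z)))) ⟩
      I (x * I (y * I z) +H x * I (I y * z)) +H (I (I x * (y * I z)) +H I (I x * (I y * z)))
        ≈⟨ H.+-congʳ (I-cong (H.trans (H.sym (*-distribˡ x (I (y * I z)) (I (I y * z)))) (*-congʳ x (H.sym (rota-baxter y z))))) ⟩
      I (x * (I y * I z)) +H (I (I x * (y * I z)) +H I (I x * (I y * z)))
        ≈⟨ H.assoc (I (x * (I y * I z))) (I (I x * (y * I z))) (I (I x * (I y * z))) ⟨
      (I (x * (I y * I z)) +H I (I x * (y * I z))) +H I (I x * (I y * z))  ∎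

    associates-I : ∀ x y z → Associates x (I y) (I z) → Associates (I x) y (I z) →
                   Associates (I x) (I y) z → Associates (I x) (I y) (I z)
    associates-I x y z h₁ h₂ h₃ = begin
      I x * I y * I z
        ≈⟨ rota-baxter-expandˡ x y z ⟩
      (I (x * I y * I z) +H I (I x * y * I z)) +H I (I x * I y * z)
        ≈⟨ H.+-cong (H.+-cong (I-cong h₁) (I-cong h₂)) (I-cong h₃) ⟩
      (I (x * (I y * I z)) +H I (I x * (y * I z))) +H I (I x * (I y * z))
        ≈⟨ rota-baxter-expandʳ x y z ⟨
      I x * (I y * I z)  ∎

  associates-gen : ∀ b b' c → Associates (gen b) (gen b') (gen c)
  associates-gen b b' c = go b b' c (<-wellFounded (weight b ℕ.+ weight b' ℕ.+ weight c))
    where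
    go : ∀ b b' c → Acc _<_ (weight b ℕ.+ weight b' ℕ.+ weight c) → Associates (gen b) (gen b') (gen c)
    go (0 , [])     b'            c  _         = associates-[0]ˡ (gen b') (gen c)
    go (0 , r ∷ rs) b'            c  (acc rec) =
      associates-pre0ˡ (gen (r , rs)) (gen b') (gen c) (go (r , rs) b' c (rec (ℕₚ.n<1+n _)))
    go b@(suc _ , _) (0 , [])     c  _         = associates-[0]-middle (gen b) (gen c)
    go b@(suc _ , _) (0 , s ∷ ss) c  (acc rec) =
      associates-pre0-middle (gen b) (gen (s , ss)) (gen c)
        (go (s , ss) b c (rec (ℕₚ.≤-reflexive (middle₁ (weight b) S (weight c)))))
        (go (s , ss) c b (rec (ℕₚ.≤-reflexive (middle₂ (weight b) S (weight c)))))
      where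
      S = weight (s , ss)
      middle₁ : ∀ p s c → suc (s ℕ.+ p ℕ.+ c) ≡ p ℕ.+ suc s ℕ.+ c
      middle₁ = solve-∀
      middle₂ : ∀ p s c → suc (s ℕ.+ c ℕ.+ p) ≡ p ℕ.+ suc s ℕ.+ c
      middle₂ = solve-∀
    go b@(suc _ , _) b'@(suc _ , _) (0 , [])     _         =
      associates-flip (gen b) (gen b') [0] (associates-[0]ˡ (gen b') (gen b))
    go b@(suc _ , _) b'@(suc _ , _) (0 , s ∷ ss) (acc rec) =
      associates-flip (gen b) (gen b') (gen (0 , s ∷ ss))
        (associates-pre0ˡ (gen (s , ss)) (gen b') (gen b)
          (go (s , ss) b' b (rec (ℕₚ.≤-reflexive (last (weight b) (weight b') S)))))
      where
      S = weight (s , ss)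
      last : ∀ p q s → suc (s ℕ.+ q ℕ.+ p) ≡ p ℕ.+ q ℕ.+ suc s
      last = solve-∀
    go (suc a , as) (suc a' , as') (suc a'' , as'') (acc rec) =
      associates-I (gen (a , as)) (gen (a' , as')) (gen (a'' , as''))
        (go (a , as) (suc a' , as') (suc a'' , as'') (rec (ℕₚ.n<1+n _)))
        (go (suc a , as) (a' , as') (suc a'' , as'') (rec (ℕₚ.≤-reflexive (second A B C))))
        (go (suc a , as) (suc a' , as') (a'' , as'') (rec (ℕₚ.≤-reflexive (third A B C))))
      where
      A = weight (a , as)
      B = weight (a' , as')
      C = weight (a'' , as'')
      second : ∀ a b c → suc (suc a ℕ.+ b ℕ.+ suc c) ≡ suc a ℕ.+ suc b ℕ.+ suc c
      second = solve-∀
      third : ∀ a b c → suc (suc a ℕ.+ suc b ℕ.+ c) ≡ suc a ℕ.+ suc b ℕ.+ suc c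
      third = solve-∀

  *-assoc : ∀ x y z → Associates x y z
  *-assoc x y z = bilinear-ext {Φ = λ x y → x * y * z} {Ψ = λ x y → x * (y * z)}
    (record { linearˡ = λ y → ∘-linear (*-linearˡ z) (*-linearˡ y)
            ; linearʳ = λ x → ∘-linear (*-linearˡ z) (*-linearʳ x) })
    (record { linearˡ = λ y → *-linearˡ (y * z)
            ; linearʳ = λ x → ∘-linear (*-linearʳ x) (*-linearˡ z) })
    (λ b b' → linear-ext (*-linearʳ (gen b * gen b')) (∘-linear (*-linearʳ (gen b)) (*-linearʳ (gen b')))
                         (associates-gen b b') z)
    x y

  H-isCRBAlgebra : IsCRBAlgebra _≈H_ _+H_ _⊔H_ 0H -H_ _·H_ I
  H-isCRBAlgebra = record
    { +-isAbelianGroup = H-isAbelianGroup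
    ; ·-cong      = λ q {x} {y} x≈y → unwrap (H.·-cong q (wrap {x} {y} x≈y))
    ; ·-distribˡ  = λ q x y → unwrap (H.·-distribˡ q x y)
    ; ·-distribʳ  = λ p q x → unwrap (H.·-distribʳ p q x)
    ; ·-assoc     = λ p q x → unwrap (H.·-assoc p q x)
    ; ·-identity  = λ x → unwrap (H.·-identity x)
    ; *-cong      = λ {x} {y} {u} {v} x≈y u≈v → unwrap (begin
        x ⊔H u    ≈⟨ ⊔H≈* x u ⟩
        x * u     ≈⟨ *-congˡ u (wrap {x} {y} x≈y) ⟩
        y * u     ≈⟨ *-congʳ y (wrap {u} {v} u≈v) ⟩
        y * v     ≈⟨ ⊔H≈* y v ⟨
        y ⊔H v    ∎)
    ; *-assoc     = λ x y z → unwrap (begin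
        (x ⊔H y) ⊔H z   ≈⟨ ⊔H≈* (x ⊔H y) z ⟩
        (x ⊔H y) * z    ≈⟨ *-congˡ z (⊔H≈* x y) ⟩
        x * y * z       ≈⟨ *-assoc x y z ⟩
        x * (y * z)     ≈⟨ *-congʳ x (⊔H≈* y z) ⟨
        x * (y ⊔H z)    ≈⟨ ⊔H≈* x (y ⊔H z) ⟨
        x ⊔H (y ⊔H z)   ∎)
    ; *-comm      = λ x y → unwrap (H.trans (⊔H≈* x y) (H.trans (*-comm x y) (H.sym (⊔H≈* y x))))
    ; distrib     =
        (λ x y z → unwrap (H.trans (⊔H≈* x (y +H z))
                     (H.trans (*-distribˡ x y z) (H.sym (H.+-cong (⊔H≈* x y) (⊔H≈* x z))))))
      , (λ x y z → unwrap (H.trans (⊔H≈* (y +H z) x)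
                     (H.trans (*-distribʳ y z x) (H.sym (H.+-cong (⊔H≈* y x) (⊔H≈* z x))))))
    ; ·-*-assoc   = λ q x y → unwrap (H.trans (⊔H≈* (q ·H x) y)
                     (H.trans (IsLinear.homo-· (*-linearˡ y) q x) (H.·-cong q (H.sym (⊔H≈* x y)))))
    ; P-cong      = λ {x} {y} x≈y → unwrap (I-cong (wrap {x} {y} x≈y))
    ; P-+         = λ x y → unwrap (IsLinear.homo-+ I-linear x y)
    ; P-·         = λ q x → unwrap (IsLinear.homo-· I-linear q x)
    ; rota-baxter = λ x y → unwrap (begin
        I x ⊔H I y                      ≈⟨ ⊔H≈* (I x) (I y) ⟩
        I x * I y                       ≈⟨ rota-baxter x y ⟩
        I (x * I y) +H I (I x * y)      ≈⟨ H.+-cong (I-cong (⊔H≈* x (I y))) (I-cong (⊔H≈* (I x) y)) ⟨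
        I (x ⊔H I y) +H I (I x ⊔H y)    ∎)
    }
    where open SetoidReasoning H.setoid

module CRBAlgebraProperties {a ℓ} (R : CRBAlgebra a ℓ) where
  open CRBAlgebra R
  open IsCRBAlgebra isCRBAlgebra

  vectorSpace : VectorSpace a ℓ
  vectorSpace = record
    { Carrier = Carrier ; _≈_ = _≈_ ; _+_ = _+_ ; 0# = 0# ; -_ = -_ ; _·_ = _·_
    ; +-isAbelianGroup = +-isAbelianGroup
    ; ·-cong = ·-cong ; ·-distribˡ = ·-distribˡ ; ·-distribʳ = ·-distribʳ
    ; ·-assoc = ·-assoc ; ·-identity = ·-identity
    }

  private module V = VectorSpace vectorSpace

  *-linearˡ : ∀ u → IsLinear vectorSpace vectorSpace (_* u)
  *-linearˡ u = record
    { cong   = λ x≈y → *-cong x≈y V.refl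
    ; homo-+ = λ x y → proj₂ distrib u x y
    ; homo-· = λ q x → ·-*-assoc q x u
    }

  *-linearʳ : ∀ u → IsLinear vectorSpace vectorSpace (u *_)
  *-linearʳ u = linear-resp vectorSpace vectorSpace (λ x → *-comm x u) (*-linearˡ u)

  P-linear : IsLinear vectorSpace vectorSpace P
  P-linear = record { cong = P-cong ; homo-+ = P-+ ; homo-· = P-· }

  rbHom-linear : ∀ {f} → IsRBHom R f → IsLinear H-vectorSpace vectorSpace f
  rbHom-linear f-hom = record { cong = f-cong ∘ unwrap ; homo-+ = f-+ ; homo-· = f-· }
    where open IsRBHom f-hom

module Universal {a ℓ} (R : CRBAlgebra a ℓ) (r : CRBAlgebra.Carrier R) where
  open CRBAlgebra R
  open IsCRBAlgebra isCRBAlgebra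
  open CRBAlgebraProperties R
  private
    module V = VectorSpace vectorSpace
    module E = Extension vectorSpace
    module S = Shuffle
  open SetoidReasoning V.setoid

  image : ℕ → List ℕ → Carrier
  image zero    []       = r
  image zero    (s ∷ ss) = r * image s ss
  image (suc a) as       = P (image a as)

  lift : H → Carrier
  lift = E.extend (uncurry image)

  lift-linear : IsLinear H-vectorSpace vectorSpace lift
  lift-linear = E.extend-linear (uncurry image)

  lift-gen : ∀ a as → lift (gen (a , as)) ≈ image a as
  lift-gen a as = E.extend-gen (uncurry image) (a , as)

  lift-pre0 : ∀ x → lift (pre0 x) ≈ r * lift x
  lift-pre0 = linear-ext (∘-linear lift-linear pre0-linear) (∘-linear (*-linearʳ r) lift-linear)
    λ (a , as) → V.trans (lift-gen 0 (a ∷ as)) (*-cong V.refl (V.sym (lift-gen a as)))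

  lift-I : ∀ x → lift (I x) ≈ P (lift x)
  lift-I = linear-ext (∘-linear lift-linear I-linear) (∘-linear P-linear lift-linear)
    λ (a , as) → V.trans (lift-gen (suc a) as) (P-cong (V.sym (lift-gen a as)))

  lift-multB : ∀ a as b bs → lift (multB a as b bs) ≈ image a as * image b bs
  lift-multB zero [] b bs = lift-gen 0 (b ∷ bs)
  lift-multB zero (s ∷ ss) b bs = begin
    lift (pre0 (multB s ss b bs))        ≈⟨ lift-pre0 (multB s ss b bs) ⟩
    r * lift (multB s ss b bs)           ≈⟨ *-cong V.refl (lift-multB s ss b bs) ⟩
    r * (image s ss * image b bs)        ≈⟨ *-assoc r _ _ ⟨
    (r * image s ss) * image b bs        ∎
  lift-multB (suc a) as zero [] = V.trans (lift-gen 0 (suc a ∷ as)) (*-comm r _)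
  lift-multB (suc a) as zero (s ∷ ss) = begin
    lift (pre0 (multB (suc a) as s ss))  ≈⟨ lift-pre0 (multB (suc a) as s ss) ⟩
    r * lift (multB (suc a) as s ss)     ≈⟨ *-cong V.refl (lift-multB (suc a) as s ss) ⟩
    r * (image (suc a) as * image s ss)  ≈⟨ *-assoc r _ _ ⟨
    (r * image (suc a) as) * image s ss  ≈⟨ *-cong (*-comm r _) V.refl ⟩
    (image (suc a) as * r) * image s ss  ≈⟨ *-assoc _ r _ ⟩
    image (suc a) as * (r * image s ss)  ∎
  lift-multB (suc a) as (suc b) bs = begin
    lift (I X +H I Y)                              ≈⟨ IsLinear.homo-+ lift-linear (I X) (I Y) ⟩
    lift (I X) + lift (I Y)                        ≈⟨ V.+-cong (lift-I X) (lift-I Y) ⟩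
    P (lift X) + P (lift Y)                        ≈⟨ V.+-cong (P-cong (lift-multB a as (suc b) bs))
                                                               (P-cong (lift-multB (suc a) as b bs)) ⟩
    P (image a as * P (image b bs)) + P (P (image a as) * image b bs)  ≈⟨ rota-baxter _ _ ⟨
    P (image a as) * P (image b bs)                ∎
    where
    X = multB a as (suc b) bs
    Y = multB (suc a) as b bs

  lift-* : ∀ x y → lift (x S.* y) ≈ lift x * lift y
  lift-* = bilinear-ext
    (record { linearˡ = λ y → ∘-linear lift-linear (S.*-linearˡ y)
            ; linearʳ = λ x → ∘-linear lift-linear (S.*-linearʳ x) })
    (record { linearˡ = λ y → ∘-linear (*-linearˡ (lift y)) lift-linear
            ; linearʳ = λ x → ∘-linear (*-linearʳ (lift x)) lift-linear })
    λ (a , as) (b , bs) → begin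
      lift (gen (a , as) S.* gen (b , bs))   ≈⟨ IsLinear.cong lift-linear (S.gen-*-gen (a , as) (b , bs)) ⟩
      lift (multB a as b bs)                 ≈⟨ lift-multB a as b bs ⟩
      image a as * image b bs                ≈⟨ *-cong (lift-gen a as) (lift-gen b bs) ⟨
      lift (gen (a , as)) * lift (gen (b , bs)) ∎

  lift-isRBHom : IsRBHom R lift
  lift-isRBHom = record
    { f-cong = λ {x} {y} x≈y → IsLinear.cong lift-linear (wrap {x} {y} x≈y)
    ; f-+    = IsLinear.homo-+ lift-linear
    ; f-·    = IsLinear.homo-· lift-linear
    ; f-*    = λ x y → V.trans (IsLinear.cong lift-linear (S.⊔H≈* x y)) (lift-* x y)
    ; f-P    = lift-I
    }

  lift-[0] : lift [0] ≈ r
  lift-[0] = lift-gen 0 []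

  lift-unique : ∀ g → IsRBHom R g → g [0] ≈ r → ∀ x → g x ≈ lift x
  lift-unique g g-hom g[0]≈r = linear-ext (rbHom-linear g-hom) lift-linear
    λ (a , as) → V.trans (on-basis a as) (V.sym (lift-gen a as))
    where
    open IsRBHom g-hom
    on-basis : ∀ a as → g (gen (a , as)) ≈ image a as
    on-basis zero    []       = g[0]≈r
    on-basis (suc a) as       = V.trans (f-P (gen (a , as))) (P-cong (on-basis a as))
    on-basis zero    (s ∷ ss) = begin
      g (gen (0 , s ∷ ss))      ≈⟨ f-cong {gen (0 , s ∷ ss)} {[0] ⊔H gen (s , ss)} (unwrap [0]-prefix) ⟩
      g ([0] ⊔H gen (s , ss))   ≈⟨ f-* [0] (gen (s , ss)) ⟩
      g [0] * g (gen (s , ss))  ≈⟨ *-cong g[0]≈r (on-basis s ss) ⟩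
      r * image s ss            ∎
      where
      [0]-prefix : gen (0 , s ∷ ss) ≈ʷ [0] ⊔H gen (s , ss)
      [0]-prefix = H.sym (H.trans (S.⊔H≈* [0] (gen (s , ss))) (S.[0]-* (gen (s , ss))))

theorem3p3 : {c ℓ : Level} →
    IsCRBAlgebra _≈H_ _+H_ _⊔H_ 0H -H_ _·H_ I ×
    ((R : CRBAlgebra c ℓ) → (r : CRBAlgebra.Carrier R) →
      Σ (H → CRBAlgebra.Carrier R) (λ f →
        IsRBHom R f ×
        CRBAlgebra._≈_ R (f [0]) r ×
        ((g : H → CRBAlgebra.Carrier R) → IsRBHom R g →
          CRBAlgebra._≈_ R (g [0]) r →
          (x : H) → CRBAlgebra._≈_ R (g x) (f x))))
theorem3p3 = Shuffle.H-isCRBAlgebra , λ R r → let open Universal R r in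
  lift , lift-isRBHom , lift-[0] , lift-unique
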